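{- Fix integers $k \ge 3$ and $i \in \{2,\dots,k-1\}$ and let $T = \{1,\dots,k\}\setminus\{i\} \subset \mathbb{Z}$. There is a function $f : \mathbb{Z} \to \{0,\dots,k-2\}$ such that for each $x \in \mathbb{Z}$, $$\sum_{y \in T} f(x-y) \equiv 1 \pmod{k-1}.$$ -}

module Defs where

open import Data.Nat using (ℕ; zero; suc; _+_; _≟_)
open import Data.Integer using (ℤ; +_; _-_)
open import Data.Fin using (Fin; toℕ)
open import Relation.Nullary using (yes; no)

sumT : ℕ → ℕ → (ℕ → ℕ) → ℕ
sumT zero    i g = 0
sumT (suc y) i g with suc y ≟ i
... | yes _ = sumT y i g
... | no  _ = g (suc y) + sumT y i g

shiftSum : (k i : ℕ) {m : ℕ} → (ℤ → Fin m) → ℤ → ℕ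
shiftSum k i f x = sumT k i (λ y → toℕ (f (x - + y)))

module Submission where

-- Write n = k - 1, i = j + 1 and T = {1,…,k} \ {i}.  We first build
-- an INTEGER-valued g : ℤ → ℤ with  Σ_{y ∈ T} g (x - y) = 1  exactly, for every x;
-- reducing g modulo n then gives the required f, since reducing each summand
-- mod n does not change the sum mod n.
--
-- Because i ∉ {1, k}, both extreme shifts 1 and k lie in T, so the equation can
-- be solved for its newest term g (x - 1) as well as for its oldest term g (x - k).
-- Starting from the window g = 0 on {0,…,n-1}, the equation therefore determines
-- g on the right (x ≥ k) by a forward linear recurrence, and on the left (x ≤ n)
-- by a backward one.

open import Defs
open import Data.Nat using (ℕ; zero; suc; pred; _≤_; _<_; _∸_; z≤n; s≤s; NonZero)
import Data.Nat as ℕ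
import Data.Nat.Properties as ℕ
open import Data.Integer using (ℤ; +_; -[1+_]; _-_; _+_; _*_; -_; 0ℤ; 1ℤ)
import Data.Integer.Properties as ℤ
open import Data.Integer.Divisibility using (_∣_)
import Data.Integer.Divisibility.Signed as Signed
open import Data.Integer.DivMod using (_%ℕ_; _/ℕ_; n%ℕd<d; a≡a%ℕn+[a/ℕn]*n)
open import Data.Integer.Tactic.RingSolver using (solve-∀)
open import Data.Fin using (Fin; toℕ; fromℕ<)
open import Data.Fin.Properties using (toℕ-fromℕ<)
open import Data.Product using (Σ; _,_)
open import Data.Sum using (_⊎_; inj₁; inj₂)
open import Data.Empty using (⊥-elim)
open import Relation.Nullary using (yes; no)
open import Relation.Binary.PropositionalEquality

sumTℤ : ℕ → ℕ → (ℕ → ℤ) → ℤ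
sumTℤ zero    i g = 0ℤ
sumTℤ (suc y) i g with suc y ℕ.≟ i
... | yes _ = sumTℤ y i g
... | no  _ = g (suc y) + sumTℤ y i g

sumTℤ-cong : ∀ k i (g h : ℕ → ℤ) → (∀ y → 1 ≤ y → y ≤ k → g y ≡ h y) →
             sumTℤ k i g ≡ sumTℤ k i h
sumTℤ-cong zero    i g h g≗h = refl
sumTℤ-cong (suc y) i g h g≗h with suc y ℕ.≟ i
... | yes _ = sumTℤ-cong y i g h (λ z 1≤z z≤y → g≗h z 1≤z (ℕ.m≤n⇒m≤1+n z≤y))
... | no  _ = cong₂ _+_ (g≗h (suc y) (s≤s z≤n) ℕ.≤-refl)
                        (sumTℤ-cong y i g h (λ z 1≤z z≤y → g≗h z 1≤z (ℕ.m≤n⇒m≤1+n z≤y)))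

sumTℤ-top : ∀ k i (g : ℕ → ℤ) → suc k ≢ i → sumTℤ (suc k) i g ≡ g (suc k) + sumTℤ k i g
sumTℤ-top k i g k+1≢i with suc k ℕ.≟ i
... | yes k+1≡i = ⊥-elim (k+1≢i k+1≡i)
... | no  _     = refl

sumTℤ-bottom : ∀ k j (g : ℕ → ℤ) → 1 ≤ j →
               sumTℤ (suc k) (suc j) g ≡ g 1 + sumTℤ k j (λ y → g (suc y))
sumTℤ-bottom zero j g 1≤j with 1 ℕ.≟ suc j
... | yes 1≡j+1 = ⊥-elim (ℕ.<⇒≢ 1≤j (ℕ.suc-injective 1≡j+1))
... | no  _     = refl
sumTℤ-bottom (suc k) j g 1≤j with suc (suc k) ℕ.≟ suc j | suc k ℕ.≟ j
... | yes _  | yes _  = sumTℤ-bottom k j g 1≤j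
... | no  _  | no  _  = trans (cong (λ t → g (suc (suc k)) + t) (sumTℤ-bottom k j g 1≤j))
                              (exchange (g (suc (suc k))) (g 1) _)
  where
  exchange : ∀ a b c → a + (b + c) ≡ b + (a + c)
  exchange = solve-∀
... | yes eq | no  ne = ⊥-elim (ne (ℕ.suc-injective eq))
... | no  ne | yes eq = ⊥-elim (ne (cong suc eq))

reduce : (n : ℕ) .{{_ : NonZero n}} → ℤ → Fin n
reduce n z = fromℕ< (n%ℕd<d z n)

sumT-reduce : ∀ n .{{_ : NonZero n}} k i (G : ℕ → ℤ) →
              (+ n) Signed.∣ (+ sumT k i (λ y → toℕ (reduce n (G y))) - sumTℤ k i G)
sumT-reduce n zero    i G = Signed.divides 0ℤ refl
sumT-reduce n (suc y) i G with suc y ℕ.≟ i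
... | yes _ = sumT-reduce n y i G
... | no  _ = subst ((+ n) Signed.∣_) (sym split)
                (Signed.∣m∣n⇒∣m+n (sumT-reduce n y i G) (Signed.divides (- (g /ℕ n)) refl))
  where
  g = G (suc y)
  R = sumT y i (λ y → toℕ (reduce n (G y)))
  regroup : ∀ ρ σ S q N → (ρ + σ) - ((ρ + q * N) + S) ≡ (σ - S) + (- q) * N
  regroup = solve-∀
  split : + (toℕ (reduce n g) ℕ.+ R) - (g + sumTℤ y i G)
          ≡ (+ R - sumTℤ y i G) + (- (g /ℕ n)) * + n
  split = begin
    + (toℕ (reduce n g) ℕ.+ R) - (g + sumTℤ y i G)
      ≡⟨ cong (λ r → + (r ℕ.+ R) - (g + sumTℤ y i G)) (toℕ-fromℕ< (n%ℕd<d g n)) ⟩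
    (+ (g %ℕ n) + + R) - (g + sumTℤ y i G)
      ≡⟨ cong (λ t → (+ (g %ℕ n) + + R) - (t + sumTℤ y i G)) (a≡a%ℕn+[a/ℕn]*n g n) ⟩
    (+ (g %ℕ n) + + R) - ((+ (g %ℕ n) + (g /ℕ n) * + n) + sumTℤ y i G)
      ≡⟨ regroup (+ (g %ℕ n)) (+ R) (sumTℤ y i G) (g /ℕ n) (+ n) ⟩
    (+ R - sumTℤ y i G) + (- (g /ℕ n)) * + n ∎
    where open ≡-Reasoning

left-or-right : ∀ (c : ℕ) (x : ℤ) →
                Σ ℕ (λ m → x ≡ + c - + m) ⊎ Σ ℕ (λ m → x ≡ + (m ℕ.+ suc c))
left-or-right c (+ a) with a ℕ.≤? c
... | yes a≤c = inj₁ (c ∸ a , sym (trans (ℤ.m-n≡m⊖n c (c ∸ a))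
                                   (trans (ℤ.⊖-≥ (ℕ.m∸n≤m c a)) (cong +_ (ℕ.m∸[m∸n]≡n a≤c)))))
... | no  a≰c = inj₂ (a ∸ suc c , cong +_ (sym (ℕ.m∸n+n≡m (ℕ.≰⇒> a≰c))))
left-or-right c -[1+ b ] = inj₁ (c ℕ.+ suc b , sym (trans (ℤ.m-n≡m⊖n c (c ℕ.+ suc b))
  (trans (ℤ.⊖-< (ℕ.m<m+n c (s≤s z≤n))) (cong (λ z → - (+ z)) (ℕ.m+n∸m≡n c (suc b))))))

+-∸ : ∀ a y → y ≤ a → + a - + y ≡ + (a ∸ y)
+-∸ a y y≤a = trans (ℤ.m-n≡m⊖n a y) (ℤ.⊖-≥ y≤a)

-- The order-n linear recurrence
--     s a = 0 for a < n,     s (m + n) + Σ_{y ∈ {1,…,n}\{r}} s (m + h y) = 1,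
-- where h sends {1,…,n} into {0,…,n-1}.  It is computed by sliding a window of
-- the last n values: window m d is meant to be s (m + d) for d < n.
module LinearRecurrence (n' r : ℕ) (h : ℕ → ℕ) where
  n : ℕ
  n = suc n'

  Window : Set
  Window = ℕ → ℤ

  next : Window → ℤ
  next w = 1ℤ - sumTℤ n r (λ y → w (h y))

  push : ℤ → Window → Window
  push v w d with suc d ℕ.<? n
  ... | yes _ = w (suc d)
  ... | no  _ = v

  push-shift : ∀ v w d → suc d < n → push v w d ≡ w (suc d)
  push-shift v w d d+1<n with suc d ℕ.<? n
  ... | yes _      = refl
  ... | no  d+1≮n = ⊥-elim (d+1≮n d+1<n)

  push-last : ∀ v w → push v w n' ≡ v
  push-last v w with suc n' ℕ.<? n
  ... | yes n<n = ⊥-elim (ℕ.<-irrefl refl n<n)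
  ... | no  _   = refl

  window : ℕ → Window
  window zero    = λ _ → 0ℤ
  window (suc m) = push (next (window m)) (window m)

  seq : ℕ → ℤ
  seq m = window m 0

  window-seq : ∀ d m → d < n → window m d ≡ seq (m ℕ.+ d)
  window-seq zero    m _     = cong seq (sym (ℕ.+-identityʳ m))
  window-seq (suc d) m d+1<n = begin
    window m (suc d)           ≡⟨ sym (push-shift _ (window m) d d+1<n) ⟩
    window (suc m) d           ≡⟨ window-seq d (suc m) (ℕ.<-trans (ℕ.n<1+n d) d+1<n) ⟩
    seq (suc m ℕ.+ d)          ≡⟨ cong seq (sym (ℕ.+-suc m d)) ⟩
    seq (m ℕ.+ suc d) ∎
    where open ≡-Reasoning

  seq-initial : ∀ a → a < n → seq a ≡ 0ℤ
  seq-initial a a<n = sym (window-seq a 0 a<n)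

  seq-recurrence : (∀ y → 1 ≤ y → y ≤ n → h y < n) → ∀ m →
                   seq (m ℕ.+ n) + sumTℤ n r (λ y → seq (m ℕ.+ h y)) ≡ 1ℤ
  seq-recurrence h<n m = begin
    seq (m ℕ.+ n) + Σold               ≡⟨ cong (λ t → t + Σold) newest ⟩
    (1ℤ - Σold) + Σold                 ≡⟨ cancel 1ℤ Σold ⟩
    1ℤ ∎
    where
    open ≡-Reasoning
    Σold = sumTℤ n r (λ y → seq (m ℕ.+ h y))
    cancel : ∀ a b → (a - b) + b ≡ a
    cancel = solve-∀
    newest : seq (m ℕ.+ n) ≡ 1ℤ - Σold
    newest = begin
      seq (m ℕ.+ n)                    ≡⟨ cong seq (ℕ.+-suc m n') ⟩
      seq (suc m ℕ.+ n')               ≡⟨ sym (window-seq n' (suc m) ℕ.≤-refl) ⟩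
      window (suc m) n'                ≡⟨ push-last _ (window m) ⟩
      next (window m)                  ≡⟨ cong (λ t → 1ℤ - t) (sumTℤ-cong n r _ _
                                            (λ y 1≤y y≤n → window-seq (h y) m (h<n y 1≤y y≤n))) ⟩
      1ℤ - Σold ∎

module IntegerSolution (n' j : ℕ) (1≤j : 1 ≤ j) (i≤n : suc j ≤ suc n') where
  n k i : ℕ
  n = suc n'
  k = suc n
  i = suc j

  -- Right of the window, x = m + k:  g (x - 1) is the newest term and the other
  -- shifts y + 1 (y ∈ {1,…,n} \ {j}) read g (m + (n - y)).
  open LinearRecurrence n' j (n ∸_) using ()
    renaming (seq to forward; seq-initial to forward-initial; seq-recurrence to forward-recurrence)
  -- Left of the window, x = n - m, read backwards via backward t = g (n - 1 - t):
  -- the shift k gives backward (m + n), the shifts y ∈ {1,…,n} \ {i} give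
  -- backward (m + (y - 1)).
  open LinearRecurrence n' i pred using ()
    renaming (seq to backward; seq-initial to backward-initial; seq-recurrence to backward-recurrence)

  solution : ℤ → ℤ
  solution (+ a)    = forward a
  solution -[1+ b ] = backward (n ℕ.+ b)

  -- On the left the solution is the backward sequence (both vanish on the window).
  solution-left : ∀ t → solution (+ n - + suc t) ≡ backward t
  solution-left t with suc t ℕ.≤? n
  ... | yes t<n = begin
    solution (+ n - + suc t)        ≡⟨ cong solution (+-∸ n (suc t) t<n) ⟩
    forward (n ∸ suc t)             ≡⟨ forward-initial _ (s≤s (ℕ.m∸n≤m n' t)) ⟩
    0ℤ                              ≡⟨ sym (backward-initial t t<n) ⟩
    backward t ∎
    where open ≡-Reasoning
  ... | no  t≮n = begin
    solution (+ n - + suc t)        ≡⟨ cong solution (trans (ℤ.m-n≡m⊖n n (suc t)) (ℤ.⊖-< n<t+1)) ⟩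
    solution (- (+ (suc t ∸ n)))    ≡⟨ cong (λ z → solution (- (+ z))) (ℕ.+-∸-assoc 1 n≤t) ⟩
    backward (n ℕ.+ (t ∸ n))        ≡⟨ cong backward (ℕ.m+[n∸m]≡n n≤t) ⟩
    backward t ∎
    where
    open ≡-Reasoning
    n<t+1 : n < suc t
    n<t+1 = ℕ.≰⇒> t≮n
    n≤t : n ≤ t
    n≤t = ℕ.≤-pred n<t+1

  solution-right : ∀ m y → y ≤ n → solution (+ (m ℕ.+ k) - + suc y) ≡ forward (m ℕ.+ (n ∸ y))
  solution-right m y y≤n = cong solution (trans (+-∸ (m ℕ.+ k) (suc y) y<k)
    (cong +_ (trans (cong (_∸ suc y) (ℕ.+-suc m n)) (ℕ.+-∸-assoc m y≤n))))
    where
    y<k : suc y ≤ m ℕ.+ k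
    y<k = ℕ.≤-trans (s≤s y≤n) (ℕ.m≤n+m k m)

  left-equation : ∀ m → sumTℤ k i (λ y → solution ((+ n - + m) - + y)) ≡ 1ℤ
  left-equation m = begin
    sumTℤ k i (λ y → solution ((+ n - + m) - + y))
      ≡⟨ sumTℤ-cong k i _ _ (λ { (suc y) _ _ → trans (cong solution (reindex y))
                                                     (solution-left (m ℕ.+ y)) }) ⟩
    sumTℤ k i (λ y → backward (m ℕ.+ pred y))
      ≡⟨ sumTℤ-top n i _ (λ k≡i → ℕ.<-irrefl (sym (ℕ.suc-injective k≡i)) i≤n) ⟩
    backward (m ℕ.+ n) + sumTℤ n i (λ y → backward (m ℕ.+ pred y))
      ≡⟨ backward-recurrence (λ { (suc y) _ y<n → y<n }) m ⟩
    1ℤ ∎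
    where
    open ≡-Reasoning
    reassoc : ∀ a b c → (a - b) - c ≡ a - (b + c)
    reassoc = solve-∀
    reindex : ∀ y → (+ n - + m) - + suc y ≡ + n - + suc (m ℕ.+ y)
    reindex y = trans (reassoc (+ n) (+ m) (+ suc y)) (cong (λ z → + n - + z) (ℕ.+-suc m y))

  right-equation : ∀ m → sumTℤ k i (λ y → solution (+ (m ℕ.+ k) - + y)) ≡ 1ℤ
  right-equation m = begin
    sumTℤ k i (λ y → solution (+ (m ℕ.+ k) - + y))
      ≡⟨ sumTℤ-bottom n j _ 1≤j ⟩
    solution (+ (m ℕ.+ k) - + 1) + sumTℤ n j (λ y → solution (+ (m ℕ.+ k) - + suc y))
      ≡⟨ cong₂ _+_ (solution-right m 0 z≤n)
                   (sumTℤ-cong n j _ _ (λ y _ y≤n → solution-right m y y≤n)) ⟩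
    forward (m ℕ.+ n) + sumTℤ n j (λ y → forward (m ℕ.+ (n ∸ y)))
      ≡⟨ forward-recurrence (λ { (suc y) _ _ → s≤s (ℕ.m∸n≤m n' y) }) m ⟩
    1ℤ ∎
    where open ≡-Reasoning

  solution-equation : ∀ x → sumTℤ k i (λ y → solution (x - + y)) ≡ 1ℤ
  solution-equation x with left-or-right n x
  ... | inj₁ (m , refl) = left-equation m
  ... | inj₂ (m , refl) = right-equation m

proposition8 : (k i : ℕ) → 3 ≤ k → 2 ≤ i → i < k →
    Σ (ℤ → Fin (k ∸ 1)) (λ f → (x : ℤ) →
      (+ (k ∸ 1)) ∣ (+ shiftSum k i f x - + 1))
proposition8 (suc (suc (suc a))) (suc (suc b)) (s≤s (s≤s (s≤s _))) (s≤s (s≤s _)) (s≤s i≤n) =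
  f , λ x → Signed.∣⇒∣ᵤ (subst (λ t → (+ n) Signed.∣ (+ shiftSum k i f x - t))
                                (solution-equation x)
                                (sumT-reduce n k i (λ y → solution (x - + y))))
  where
  open IntegerSolution (suc a) (suc b) (s≤s z≤n) i≤n
  f : ℤ → Fin n
  f x = reduce n (solution x)
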